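{- Let $n\ge 4$ and $G=\operatorname{SD}_{2^n}=\langle a,b\mid a^{2^{n-1}}=b^2=1,\ bab=a^{2^{n-2}-1}\rangle$. For $H\le G$ put $P(H)=\log_2|H|$. For $0\le j<k\le n$ let $\alpha(j,k)$ be the number of $G$-conjugacy classes of pairs $(H,K)$ of subgroups with $H\subsetneq K$, $P(H)=j$, $P(K)=k$ (where $G$ acts by simultaneous conjugation). Then \[\alpha(j,k)=\begin{cases}1 & j=0,\ k=n,\\ 2 & j=0,\ k=1,\\ 3 & j=0,\ 2\le k\le n-1,\\ 2 & j=1,\ k=n,\\ 3 & 2\le j\le n-1,\ k=n,\\ 4 & j=1,\ 2\le k\le n-1,\\ 5 & 2\le j<k\le n-1.\end{cases}\] -}

module Defs where

open import Data.Nat using (ℕ; zero; suc; _+_; _*_; _∸_; _^_; NonZero)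
open import Data.Nat.Properties using (m^n≢0)
open import Data.Nat.DivMod using (_mod_)
open import Data.Fin using (Fin; toℕ)
open import Data.Bool using (Bool; true; false; _xor_; if_then_else_)
open import Data.List using (List; map; _++_; length; filterᵇ; allFin)
open import Data.Product using (Σ; _×_; _,_; ∃-syntax)
open import Relation.Nullary using (¬_)
open import Relation.Binary.PropositionalEquality using (_≡_)

-- Concrete model of SD_{2^n} = ⟨a,b | a^{2^{n-1}} = b^2 = 1, bab = a^{2^{n-2}-1}⟩.
-- The element (i , e) stands for a^i b^e  (i mod 2^{n-1}, e ∈ {0,1}).

N : ℕ → ℕ
N n = 2 ^ (n ∸ 1)

modN : ∀ n → ℕ → Fin (N n)
modN n x = _mod_ x (N n) {{m^n≢0 2 (n ∸ 1)}}

-- twisting exponent r = 2^{n-2} - 1, so that b a b⁻¹ = a^r, b a^j = a^{r j} b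
r : ℕ → ℕ
r n = 2 ^ (n ∸ 2) ∸ 1

SD : ℕ → Set
SD n = Fin (N n) × Bool

-- (a^i b^e)(a^j b^f) = a^{i + r^e j} b^{e+f}
mul : ∀ n → SD n → SD n → SD n
mul n (i , e) (j , f) =
  (modN n (toℕ i + (if e then r n * toℕ j else toℕ j)) , e xor f)

one : ∀ n → SD n
one n = (modN n 0 , false)

-- (a^i)⁻¹ = a^{-i};  (a^i b)⁻¹ = b a^{-i} = a^{-r i} b
inv : ∀ n → SD n → SD n
inv n (i , false) = (modN n (N n ∸ toℕ i) , false)
inv n (i , true)  = (modN n (N n ∸ toℕ (modN n (r n * toℕ i))) , true)

elems : ∀ n → List (SD n)
elems n = map (λ i → (i , false)) (allFin (N n)) ++ map (λ i → (i , true)) (allFin (N n))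

Sub : ℕ → Set
Sub n = SD n → Bool

Mem : ∀ n → SD n → Sub n → Set
Mem n x H = H x ≡ true

IsSubgroup : ∀ n → Sub n → Set
IsSubgroup n H =
  Mem n (one n) H
  × (∀ x y → Mem n x H → Mem n y H → Mem n (mul n x y) H)
  × (∀ x → Mem n x H → Mem n (inv n x) H)

order : ∀ n → Sub n → ℕ
order n H = length (filterᵇ H (elems n))

SameSub : ∀ n → Sub n → Sub n → Set
SameSub n H K = ∀ x → H x ≡ K x

Included : ∀ n → Sub n → Sub n → Set
Included n H K = ∀ x → Mem n x H → Mem n x K

conjSub : ∀ n → SD n → Sub n → Sub n
conjSub n g H x = H (mul n (mul n (inv n g) x) g)

IsPair : ∀ n → ℕ → ℕ → Sub n × Sub n → Set
IsPair n j k (H , K) =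
  IsSubgroup n H × IsSubgroup n K
  × Included n H K × ¬ SameSub n H K
  × order n H ≡ 2 ^ j × order n K ≡ 2 ^ k

ConjPair : ∀ n → Sub n × Sub n → Sub n × Sub n → Set
ConjPair n (H , K) (H' , K') =
  ∃[ g ] (SameSub n H' (conjSub n g H) × SameSub n K' (conjSub n g K))

-- α(j,k) = c : there are exactly c G-conjugacy classes of such pairs,
-- witnessed by c pairwise non-conjugate representatives covering all pairs.
ClassCount : ℕ → ℕ → ℕ → ℕ → Set
ClassCount n j k c =
  Σ (Fin c → Sub n × Sub n) λ rep →
    (∀ i → IsPair n j k (rep i))
    × (∀ i i' → ConjPair n (rep i) (rep i') → i ≡ i')
    × (∀ p → IsPair n j k p → ∃[ i ] ConjPair n p (rep i))

{-# OPTIONS --safe #-}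
-- Write the elements of G = SD_{2^n} as a^i b^ε. The exponents i of the powers of a lying in a subgroup H
-- form a subgroup of ℤ/2^(n-1), i.e. the multiples of its least positive element d, and if H contains
-- some a^c b then its elements a^i b are exactly those with i ≡ c (mod d). So H = ⟨a^d⟩ or ⟨a^d, a^c b⟩,
-- and |H| determines d. Conjugating by a suitable power of a replaces c by its parity, while the parity
-- of i in a^i b is a conjugation invariant (i mod 2 is a homomorphism onto an abelian group). Hence every
-- pair H ⊊ K is conjugate to a standard pair of shape (cyclic, cyclic), (cyclic, ⟨a^d, a^ε b⟩) or
-- (⟨a^d, a^ε b⟩, ⟨a^d′, a^ε b⟩), and the parities of the exponents of the a^i b in H and in K tell these
-- apart. Since (a^c b)² = a^((1+r)c) with 1 + r = 2^(n-2), an odd c forces d ∣ 2^(n-2), which rules out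
-- subgroups of order 2; and when K = G both parities occur in K, so the two shapes (cyclic, G) coincide.
module Submission where

open import Defs
open import Data.Bool using (Bool; true; false; T; not; _xor_; if_then_else_)
open import Data.Bool.Properties using (T-≡; ⇔→≡; xor-identityʳ; xor-assoc; xor-same)
import Data.Bool.Properties as Bool
open import Data.Fin using (Fin; toℕ; #_) renaming (zero to fzero; suc to fsuc)
import Data.Fin as Fin
open import Data.Fin.Properties using (all?; toℕ-fromℕ<; toℕ-injective; toℕ<n)
open import Data.List using (_∷_; map; _++_; length; filterᵇ; tabulate; allFin)
open import Data.List.Properties using (map-tabulate; length-++; filter-++; filter-≐)
open import Data.Nat
open import Data.Nat.DivMod
open import Data.Nat.Divisibility using (_∣_; divides; quotient; m%n≡0⇒n∣m; n∣m⇒m%n≡0; m∣n⇒n≡quotient*m)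
open import Data.Nat.Induction using (<-rec)
open import Data.Nat.Properties
open import Data.Nat.Tactic.RingSolver using (solve-∀)
open import Data.Product using (_×_; _,_; proj₁; proj₂; ∃-syntax)
open import Data.Product.Properties using (≡-dec)
open import Data.Sum using (_⊎_; inj₁; inj₂)
open import Function using (_∘_; _⇔_; mk⇔; Equivalence)
open import Function.Construct.Composition using () renaming (equivalence to ⇔-trans)
open import Function.Construct.Symmetry using (⇔-sym)
open import Relation.Binary.Bundles using (Setoid)
open import Relation.Binary.Definitions using (DecidableEquality)
open import Relation.Binary.PropositionalEquality hiding ([_])
import Relation.Binary.Reasoning.Setoid
open import Relation.Nullary using (Dec; yes; no; ¬_; contradiction)
open import Relation.Nullary.Decidable using (T?; _→-dec_; True; toWitness)
open import Relation.Nullary.Reflects using (Reflects; ofʸ; ofⁿ; det)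

bit : Bool → ℕ
bit false = 0
bit true  = 1

≡ᵇ≡true⇔≡ : ∀ {m n} → (m ≡ᵇ n) ≡ true ⇔ m ≡ n
≡ᵇ≡true⇔≡ {m} {n} = mk⇔ (≡ᵇ⇒≡ m n ∘ Equivalence.from T-≡) (Equivalence.to T-≡ ∘ ≡⇒≡ᵇ m n)

≡true⇔⇒≡ : ∀ {b b′ : Bool} {P : Set} → b ≡ true ⇔ P → b′ ≡ true ⇔ P → b ≡ b′
≡true⇔⇒≡ b⇔P b′⇔P = ⇔→≡ (⇔-trans b⇔P (⇔-sym b′⇔P))

odd : ℕ → Bool
odd c = c % 2 ≡ᵇ 1

bit-odd : ∀ c → c ≡ bit (odd c) + 2 * (c / 2)
bit-odd c with c % 2 in c%2 | m%n<n c 2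
... | 0 | _ = trans (m≡m%n+[m/n]*n c 2) (trans (cong (_+ c / 2 * 2) c%2) (*-comm (c / 2) 2))
... | 1 | _ = trans (m≡m%n+[m/n]*n c 2) (trans (cong (_+ c / 2 * 2) c%2) (cong suc (*-comm (c / 2) 2)))
... | 2+ _ | s<s (s<s ())

^-monoʳ-∣ : ∀ m {i j} → i ≤ j → m ^ i ∣ m ^ j
^-monoʳ-∣ m {i} {j} i≤j = divides (m ^ (j ∸ i)) (begin
  m ^ j               ≡⟨ cong (m ^_) (m+[n∸m]≡n i≤j) ⟨
  m ^ (i + (j ∸ i))   ≡⟨ ^-distribˡ-+-* m i (j ∸ i) ⟩
  m ^ i * m ^ (j ∸ i) ≡⟨ *-comm (m ^ i) _ ⟩
  m ^ (j ∸ i) * m ^ i ∎)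
  where open ≡-Reasoning

^-factor : ∀ {b m j d} → 1 < b → b ^ m ≡ b ^ j * d → j ≤ m × d ≡ b ^ (m ∸ j)
^-factor {b@(suc _)} {m} {j} {d} 1<b bᵐ≡bʲd = j≤m , *-cancelˡ-≡ d (b ^ (m ∸ j)) (b ^ j) {{m^n≢0 b j}} (begin
  b ^ j * d               ≡⟨ bᵐ≡bʲd ⟨
  b ^ m                   ≡⟨ cong (b ^_) (m+[n∸m]≡n j≤m) ⟨
  b ^ (j + (m ∸ j))       ≡⟨ ^-distribˡ-+-* b j (m ∸ j) ⟩
  b ^ j * b ^ (m ∸ j)     ∎)
  where
  open ≡-Reasoning
  d≢0 : d ≢ 0
  d≢0 refl = ≢-nonZero⁻¹ (b ^ m) {{m^n≢0 b m}} (trans bᵐ≡bʲd (*-zeroʳ (b ^ j)))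
  j≤m : j ≤ m
  j≤m with j ≤? m
  ... | yes j≤m = j≤m
  ... | no  j≰m = contradiction
    (<-≤-trans (^-monoʳ-< b 1<b (≰⇒> j≰m))
               (≤-trans (m≤m*n (b ^ j) d {{≢-nonZero d≢0}}) (≤-reflexive (sym bᵐ≡bʲd))))
    (<-irrefl refl)

count : (ℕ → Bool) → ℕ → ℕ
count P zero    = 0
count P (suc m) = bit (P 0) + count (P ∘ suc) m

count-cong : ∀ m {P Q : ℕ → Bool} → (∀ {x} → x < m → P x ≡ Q x) → count P m ≡ count Q m
count-cong zero    P≡Q = refl
count-cong (suc m) P≡Q = cong₂ _+_ (cong bit (P≡Q z<s)) (count-cong m (P≡Q ∘ s<s))

count-+ : ∀ a b (P : ℕ → Bool) → count P (a + b) ≡ count P a + count (λ x → P (a + x)) b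
count-+ zero    b P = refl
count-+ (suc a) b P = trans (cong (bit (P 0) +_) (count-+ a b (P ∘ suc))) (sym (+-assoc (bit (P 0)) _ _))

count-periodic : ∀ u d (P : ℕ → Bool) → (∀ x → P (d + x) ≡ P x) → count P (u * d) ≡ u * count P d
count-periodic zero    d P per = refl
count-periodic (suc u) d P per = trans (count-+ d (u * d) P)
  (cong (count P d +_) (trans (count-cong (u * d) (λ {x} _ → per x)) (count-periodic u d P per)))

count-false : ∀ m → count (λ _ → false) m ≡ 0
count-false zero    = refl
count-false (suc m) = count-false m

count-≡ : ∀ {c d} → c < d → count (_≡ᵇ c) d ≡ 1
count-≡ {zero}  {suc d} _         = cong suc (count-false d)
count-≡ {suc c} {suc d} (s<s c<d) = count-≡ c<d

count-residue : ∀ u d .{{_ : NonZero d}} c → count (λ x → x % d ≡ᵇ c % d) (u * d) ≡ u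
count-residue u d c = begin
  count (λ x → x % d ≡ᵇ c % d) (u * d)
    ≡⟨ count-periodic u d _ (λ x → cong (_≡ᵇ c % d) (d+x%d x)) ⟩
  u * count (λ x → x % d ≡ᵇ c % d) d
    ≡⟨ cong (u *_) (count-cong d (λ x<d → cong (_≡ᵇ c % d) (m<n⇒m%n≡m x<d))) ⟩
  u * count (_≡ᵇ c % d) d              ≡⟨ cong (u *_) (count-≡ (m%n<n c d)) ⟩
  u * 1                                ≡⟨ *-identityʳ u ⟩
  u                                    ∎
  where
  open ≡-Reasoning
  d+x%d : ∀ x → (d + x) % d ≡ x % d
  d+x%d x = trans (cong (_% d) (+-comm d x)) ([m+n]%n≡m%n x d)

length-filterᵇ-∷ : ∀ {A : Set} (P : A → Bool) x xs →
  length (filterᵇ P (x ∷ xs)) ≡ bit (P x) + length (filterᵇ P xs)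
length-filterᵇ-∷ P x xs with P x
... | true  = refl
... | false = refl

length-filterᵇ-tabulate : ∀ {A : Set} m (f : Fin m → A) (P : A → Bool) (Q : ℕ → Bool) →
  (∀ i → P (f i) ≡ Q (toℕ i)) → length (filterᵇ P (tabulate f)) ≡ count Q m
length-filterᵇ-tabulate zero    f P Q eq = refl
length-filterᵇ-tabulate (suc m) f P Q eq = trans (length-filterᵇ-∷ P (f fzero) _)
  (cong₂ _+_ (cong bit (eq fzero)) (length-filterᵇ-tabulate m (f ∘ fsuc) P (Q ∘ suc) (eq ∘ fsuc)))

IsLeast : (ℕ → Bool) → ℕ → Set
IsLeast P x = P x ≡ true × ∀ {y} → y < x → P y ≡ false

least : (P : ℕ → Bool) → ∀ m → P m ≡ true → ∃[ x ] IsLeast P x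
least P = <-rec _ search
  where
  search : ∀ m → (∀ {y} → y < m → P y ≡ true → ∃[ x ] IsLeast P x) → P m ≡ true → ∃[ x ] IsLeast P x
  search m rec Pm with anyUpTo? (T? ∘ P) m
  ... | yes (y , y<m , Py) = rec y<m (Equivalence.to T-≡ Py)
  ... | no ∄y              = m , Pm , below
    where
    below : ∀ {z} → z < m → P z ≡ false
    below {z} z<m with P z in Pz
    ... | true  = contradiction (z , z<m , Equivalence.from T-≡ Pz) ∄y
    ... | false = refl

module Congruence (d : ℕ) .{{_ : NonZero d}} where

  infix 4 _≈_
  record _≈_ (a b : ℕ) : Set where
    constructor mk≈
    field %-≡ : a % d ≡ b % d
  open _≈_ public

  ≈-refl : ∀ {a} → a ≈ a
  ≈-refl = mk≈ refl

  ≈-sym : ∀ {a b} → a ≈ b → b ≈ a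
  ≈-sym (mk≈ eq) = mk≈ (sym eq)

  ≈-trans : ∀ {a b c} → a ≈ b → b ≈ c → a ≈ c
  ≈-trans (mk≈ eq) (mk≈ eq′) = mk≈ (trans eq eq′)

  ≡⇒≈ : ∀ {a b} → a ≡ b → a ≈ b
  ≡⇒≈ refl = ≈-refl

  infix 4 _≈ᵇ_
  _≈ᵇ_ : ℕ → ℕ → Bool
  a ≈ᵇ b = a % d ≡ᵇ b % d

  ≈ᵇ≡true⇔≈ : ∀ {a b} → (a ≈ᵇ b) ≡ true ⇔ a ≈ b
  ≈ᵇ≡true⇔≈ = mk⇔ (mk≈ ∘ Equivalence.to ≡ᵇ≡true⇔≡) (Equivalence.from ≡ᵇ≡true⇔≡ ∘ %-≡)

  ≈-setoid : Setoid _ _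
  ≈-setoid = record
    { Carrier = ℕ ; _≈_ = _≈_
    ; isEquivalence = record { refl = ≈-refl ; sym = ≈-sym ; trans = ≈-trans } }

  module ≈-Reasoning = Relation.Binary.Reasoning.Setoid ≈-setoid

  %-≈ : ∀ a → a % d ≈ a
  %-≈ a = mk≈ (m%n%n≡m%n a d)

  ≈-by-multiple : ∀ {a b} k → a ≡ b + k * d → a ≈ b
  ≈-by-multiple {b = b} k refl = mk≈ ([m+kn]%n≡m%n b k d)

  d≈0 : d ≈ 0
  d≈0 = ≈-by-multiple 1 (sym (+-identityʳ d))

  +-cong : ∀ {a b c e} → a ≈ b → c ≈ e → a + c ≈ b + e
  +-cong {a} {b} {c} {e} (mk≈ a≈b) (mk≈ c≈e) = mk≈ (begin
    (a + c) % d             ≡⟨ %-distribˡ-+ a c d ⟩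
    (a % d + c % d) % d     ≡⟨ cong₂ (λ x y → (x + y) % d) a≈b c≈e ⟩
    (b % d + e % d) % d     ≡⟨ %-distribˡ-+ b e d ⟨
    (b + e) % d             ∎)
    where open ≡-Reasoning

  +-congˡ : ∀ a {b c} → b ≈ c → a + b ≈ a + c
  +-congˡ a = +-cong (≈-refl {a})

  +-congʳ : ∀ c {a b} → a ≈ b → a + c ≈ b + c
  +-congʳ c a≈b = +-cong a≈b (≈-refl {c})

  *-congˡ : ∀ a {b c} → b ≈ c → a * b ≈ a * c
  *-congˡ a {b} {c} (mk≈ b≈c) = mk≈ (begin
    (a * b) % d             ≡⟨ %-distribˡ-* a b d ⟩
    (a % d * (b % d)) % d   ≡⟨ cong (λ y → (a % d * y) % d) b≈c ⟩
    (a % d * (c % d)) % d   ≡⟨ %-distribˡ-* a c d ⟨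
    (a * c) % d             ∎)
    where open ≡-Reasoning

  +-cancelʳ : ∀ {a b} z → a + z ≈ b + z → a ≈ b
  +-cancelʳ {a} {b} z a+z≈b+z = begin
    a                        ≈⟨ ≈-by-multiple z refl ⟨
    a + z * d                ≡⟨ shift a ⟩
    a + z + pred d * z       ≈⟨ +-congʳ (pred d * z) a+z≈b+z ⟩
    b + z + pred d * z       ≡⟨ shift b ⟨
    b + z * d                ≈⟨ ≈-by-multiple z refl ⟩
    b                        ∎
    where
    open ≈-Reasoning
    shift : ∀ x → x + z * d ≡ x + z + pred d * z
    shift x = E.begin
      x + z * d                E.≡⟨ cong (λ m → x + z * m) (suc-pred d) ⟨
      x + z * suc (pred d)     E.≡⟨ cong (x +_) (*-suc z (pred d)) ⟩
      x + (z + z * pred d)     E.≡⟨ cong (λ m → x + (z + m)) (*-comm z (pred d)) ⟩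
      x + (z + pred d * z)     E.≡⟨ +-assoc x z _ ⟨
      x + z + pred d * z       E.∎
      where module E = ≡-Reasoning

≈-weaken : ∀ d e .{{_ : NonZero d}} .{{_ : NonZero e}} → d ∣ e →
  ∀ {a b} → Congruence._≈_ e a b → Congruence._≈_ d a b
≈-weaken d e d∣e {a} {b} (Congruence.mk≈ a≈b) = Congruence.mk≈ (begin
  a % d       ≡⟨ m∣n⇒o%n%m≡o%m d e a d∣e ⟨
  a % e % d   ≡⟨ cong (_% d) a≈b ⟩
  b % e % d   ≡⟨ m∣n⇒o%n%m≡o%m d e b d∣e ⟩
  b % d       ∎)
  where open ≡-Reasoning

module AdditiveSubmonoid (N : ℕ) .{{_ : NonZero N}} (S : ℕ → Bool)
  (S-cong : ∀ {a b} → Congruence._≈_ N a b → S a ≡ S b)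
  (S-0 : S 0 ≡ true)
  (S-+ : ∀ {a b} → S a ≡ true → S b ≡ true → S (a + b) ≡ true) where

  open Congruence N

  S-* : ∀ k {a} → S a ≡ true → S (k * a) ≡ true
  S-* zero    Sa = S-0
  S-* (suc k) Sa = S-+ Sa (S-* k Sa)

  S-N : S N ≡ true
  S-N = trans (S-cong d≈0) S-0

  private
    leastPositive : ∃[ x ] IsLeast (S ∘ suc) x
    leastPositive = least (S ∘ suc) (pred N) (trans (cong S (suc-pred N)) S-N)

  period : ℕ
  period = suc (proj₁ leastPositive)

  S-period : S period ≡ true
  S-period = proj₁ (proj₂ leastPositive)

  S-residue : ∀ {x} → S x ≡ true → S (x % period) ≡ true
  S-residue {x} Sx = trans (S-cong x%p≡) (S-+ Sx (S-* (pred N) (S-* (x / period) S-period)))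
    where
    y = x / period * period
    x%p≡ : x % period ≈ x + pred N * y
    x%p≡ = ≈-sym (≈-by-multiple y (begin
      x + pred N * y                ≡⟨ cong (λ m → m + pred N * y) (m≡m%n+[m/n]*n x period) ⟩
      x % period + y + pred N * y   ≡⟨ +-assoc (x % period) y _ ⟩
      x % period + suc (pred N) * y ≡⟨ cong (λ m → x % period + m * y) (suc-pred N) ⟩
      x % period + N * y            ≡⟨ cong (x % period +_) (*-comm N y) ⟩
      x % period + y * N            ∎))
      where open ≡-Reasoning

  private module P = Congruence period

  S⇒≈0 : ∀ {x} → S x ≡ true → x P.≈ 0
  S⇒≈0 {x} Sx = P.mk≈ (trans (residue-zero (x % period) (m%n<n x period) (S-residue Sx)) (sym (m*n%n≡0 0 period)))
    where
    residue-zero : ∀ m → m < period → S m ≡ true → m ≡ 0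
    residue-zero zero    _         _  = refl
    residue-zero (suc m) (s<s m<p) Sm with () ← trans (sym Sm) (proj₂ (proj₂ leastPositive) m<p)

  ≈0⇒S : ∀ {x} → x P.≈ 0 → S x ≡ true
  ≈0⇒S {x} (P.mk≈ x%p≡0) = subst (λ m → S m ≡ true) (sym x≡) (S-* (x / period) S-period)
    where
    x≡ : x ≡ x / period * period
    x≡ = trans (m≡m%n+[m/n]*n x period) (cong (_+ x / period * period) (trans x%p≡0 (m*n%n≡0 0 period)))

  S≡≈ᵇ0 : ∀ x → S x ≡ (x P.≈ᵇ 0)
  S≡≈ᵇ0 x = ≡true⇔⇒≡ (mk⇔ S⇒≈0 ≈0⇒S) P.≈ᵇ≡true⇔≈

  period∣N : period ∣ N
  period∣N = m%n≡0⇒n∣m N period (trans (P.%-≡ (S⇒≈0 S-N)) (m*n%n≡0 0 period))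

Reflects-⇔ : ∀ {A B : Set} {b} → A ⇔ B → Reflects A b → Reflects B b
Reflects-⇔ A⇔B (ofʸ a)  = ofʸ (Equivalence.to A⇔B a)
Reflects-⇔ A⇔B (ofⁿ ¬a) = ofⁿ (¬a ∘ Equivalence.from A⇔B)

injective? : ∀ {c} {A : Set} → DecidableEquality A → (f : Fin c → A) → Dec (∀ i i′ → f i ≡ f i′ → i ≡ i′)
injective? _≟_ f = all? λ i → all? λ i′ → (f i ≟ f i′) →-dec (i Fin.≟ i′)

module Semidihedral (p : ℕ) where

  n : ℕ
  n = 4 + p

  instance
    N≢0 : NonZero (N n)
    N≢0 = m^n≢0 2 (n ∸ 1)

  -- With 2 ^ p = 1 + q we get N n = 8 + 8q, r n = R = 3 + 4q and M = 7 + 8q ≡ -1 (mod N n):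
  -- polynomials in q, so that the ring solver can verify the congruences below.
  q : ℕ
  q = pred (2 ^ p)

  2^p≡1+q : 2 ^ p ≡ suc q
  2^p≡1+q = sym (suc-pred (2 ^ p) {{m^n≢0 2 p}})

  N≡ : N n ≡ 8 + 8 * q
  N≡ = trans (cong (λ m → 2 * (2 * (2 * m))) 2^p≡1+q) (poly q)
    where
    poly : ∀ q → 2 * (2 * (2 * suc q)) ≡ 8 + 8 * q
    poly = solve-∀

  R : ℕ
  R = 3 + 4 * q

  r≡R : r n ≡ R
  r≡R = cong (_∸ 1) (trans (cong (λ m → 2 * (2 * m)) 2^p≡1+q) (poly q))
    where
    poly : ∀ q → 2 * (2 * suc q) ≡ 4 + 4 * q
    poly = solve-∀

  1+R≡2^[n-2] : 1 + R ≡ 2 ^ (n ∸ 2)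
  1+R≡2^[n-2] = sym (trans (cong (λ m → 2 * (2 * m)) 2^p≡1+q) (poly q))
    where
    poly : ∀ q → 2 * (2 * suc q) ≡ 4 + 4 * q
    poly = solve-∀

  M : ℕ
  M = 7 + 8 * q

  open Congruence (N n) public
  module Parity = Congruence 2

  ≈-by-multiple′ : ∀ {a b} k → a ≡ b + k * (8 + 8 * q) → a ≈ b
  ≈-by-multiple′ {b = b} k eq = ≈-by-multiple k (trans eq (cong (λ m → b + k * m) (sym N≡)))

  infixl 7 _·_
  _·_ : SD n → SD n → SD n
  _·_ = mul n

  infix 8 _⁻¹
  _⁻¹ : SD n → SD n
  _⁻¹ = inv n

  e : SD n
  e = one n

  exp : SD n → ℕ
  exp x = toℕ (proj₁ x)

  rot : ℕ → SD n
  rot t = (modN n t , false)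

  ref : ℕ → SD n
  ref t = (modN n t , true)

  toℕ-modN : ∀ t → toℕ (modN n t) ≡ t % N n
  toℕ-modN t = toℕ-fromℕ< _

  exp-modN : ∀ t → toℕ (modN n t) ≈ t
  exp-modN t = ≈-trans (≡⇒≈ (toℕ-modN t)) (%-≈ t)

  modN-cong : ∀ {s t} → s ≈ t → modN n s ≡ modN n t
  modN-cong {s} {t} (mk≈ s≈t) = toℕ-injective (trans (toℕ-modN s) (trans s≈t (sym (toℕ-modN t))))

  modN-toℕ : ∀ i → modN n (toℕ i) ≡ i
  modN-toℕ i = toℕ-injective (trans (toℕ-modN (toℕ i)) (m<n⇒m%n≡m (toℕ<n i)))

  SD-ext : ∀ {x y : SD n} → exp x ≈ exp y → proj₂ x ≡ proj₂ y → x ≡ y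
  SD-ext {i , ε} {j , .ε} (mk≈ i≈j) refl =
    cong (_, ε) (toℕ-injective (trans (sym (m<n⇒m%n≡m (toℕ<n i))) (trans i≈j (m<n⇒m%n≡m (toℕ<n j)))))

  twist : Bool → ℕ → ℕ
  twist false t = t
  twist true  t = R * t

  exp-· : ∀ x y → exp (x · y) ≈ exp x + twist (proj₂ x) (exp y)
  exp-· (i , false) (j , _) = exp-modN _
  exp-· (i , true)  (j , _) = ≈-trans (exp-modN _) (≡⇒≈ (cong (λ m → toℕ i + m * toℕ j) r≡R))

  M*t+t≈0 : ∀ t → M * t + t ≈ 0
  M*t+t≈0 t = ≈-by-multiple′ t (poly t q)
    where
    poly : ∀ t q → (7 + 8 * q) * t + t ≡ 0 + t * (8 + 8 * q)
    poly = solve-∀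

  N∸t≈M*t : ∀ t → N n ∸ t % N n ≈ M * t
  N∸t≈M*t t = +-cancelʳ t (≈-trans N∸t+t≈0 (≈-sym (M*t+t≈0 t)))
    where
    open ≈-Reasoning
    N∸t+t≈0 : N n ∸ t % N n + t ≈ 0
    N∸t+t≈0 = begin
      N n ∸ t % N n + t        ≈⟨ +-congˡ (N n ∸ t % N n) (%-≈ t) ⟨
      N n ∸ t % N n + t % N n  ≡⟨ m∸n+n≡m (m%n≤n t (N n)) ⟩
      N n                      ≈⟨ d≈0 ⟩
      0                        ∎

  exp-⁻¹ : ∀ x → exp (x ⁻¹) ≈ M * twist (proj₂ x) (exp x)
  exp-⁻¹ (i , false) = begin
    toℕ (modN n (N n ∸ toℕ i))   ≈⟨ exp-modN _ ⟩
    N n ∸ toℕ i                   ≡⟨ cong (N n ∸_) (m<n⇒m%n≡m (toℕ<n i)) ⟨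
    N n ∸ toℕ i % N n             ≈⟨ N∸t≈M*t (toℕ i) ⟩
    M * toℕ i                     ∎
    where open ≈-Reasoning
  exp-⁻¹ (i , true) = begin
    toℕ (modN n (N n ∸ toℕ (modN n (r n * toℕ i))))   ≈⟨ exp-modN _ ⟩
    N n ∸ toℕ (modN n (r n * toℕ i))                   ≡⟨ cong (λ m → N n ∸ toℕ (modN n (m * toℕ i))) r≡R ⟩
    N n ∸ toℕ (modN n (R * toℕ i))                     ≡⟨ cong (N n ∸_) (toℕ-modN _) ⟩
    N n ∸ R * toℕ i % N n                              ≈⟨ N∸t≈M*t (R * toℕ i) ⟩
    M * (R * toℕ i)                                    ∎
    where open ≈-Reasoning

  R*R≈1 : ∀ t → R * (R * t) ≈ t
  R*R≈1 t = ≈-by-multiple′ (t * (1 + 2 * q)) (poly t q)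
    where
    poly : ∀ t q → (3 + 4 * q) * ((3 + 4 * q) * t) ≡ t + t * (1 + 2 * q) * (8 + 8 * q)
    poly = solve-∀

  twist-xor : ∀ ε δ t → twist (ε xor δ) t ≈ twist ε (twist δ t)
  twist-xor false δ     t = ≈-refl
  twist-xor true  false t = ≈-refl
  twist-xor true  true  t = ≈-sym (R*R≈1 t)

  twist-+ : ∀ ε s t → twist ε (s + t) ≡ twist ε s + twist ε t
  twist-+ false s t = refl
  twist-+ true  s t = *-distribˡ-+ R s t

  twist-zero : ∀ ε → twist ε 0 ≡ 0
  twist-zero false = refl
  twist-zero true  = *-zeroʳ R

  twist-cong : ∀ m .{{_ : NonZero m}} ε {s t} → Congruence._≈_ m s t → Congruence._≈_ m (twist ε s) (twist ε t)
  twist-cong m false s≈t = s≈t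
  twist-cong m true  s≈t = Congruence.*-congˡ m R s≈t

  ·-assoc : ∀ x y z → x · y · z ≡ x · (y · z)
  ·-assoc x@(_ , ε) y@(_ , δ) z = SD-ext exp≈ (xor-assoc ε δ (proj₂ z))
    where
    open ≈-Reasoning
    exp≈ : exp (x · y · z) ≈ exp (x · (y · z))
    exp≈ = begin
      exp (x · y · z)                                    ≈⟨ exp-· (x · y) z ⟩
      exp (x · y) + twist (ε xor δ) (exp z)              ≈⟨ +-cong (exp-· x y) (twist-xor ε δ (exp z)) ⟩
      exp x + twist ε (exp y) + twist ε (twist δ (exp z)) ≡⟨ +-assoc (exp x) _ _ ⟩
      exp x + (twist ε (exp y) + twist ε (twist δ (exp z))) ≡⟨ cong (exp x +_) (twist-+ ε (exp y) _) ⟨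
      exp x + twist ε (exp y + twist δ (exp z))          ≈⟨ +-congˡ (exp x) (twist-cong (N n) ε (exp-· y z)) ⟨
      exp x + twist ε (exp (y · z))                      ≈⟨ exp-· x (y · z) ⟨
      exp (x · (y · z))                                  ∎

  exp-e : exp e ≈ 0
  exp-e = exp-modN 0

  ·-identityˡ : ∀ x → e · x ≡ x
  ·-identityˡ x = SD-ext (≈-trans (exp-· e x) (+-congʳ (exp x) exp-e)) refl

  ·-identityʳ : ∀ x → x · e ≡ x
  ·-identityʳ x@(_ , ε) = SD-ext exp≈ (xor-identityʳ ε)
    where
    open ≈-Reasoning
    exp≈ : exp (x · e) ≈ exp x
    exp≈ = begin
      exp (x · e)                ≈⟨ exp-· x e ⟩
      exp x + twist ε (exp e)    ≈⟨ +-congˡ (exp x) (twist-cong (N n) ε exp-e) ⟩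
      exp x + twist ε 0          ≡⟨ cong (exp x +_) (twist-zero ε) ⟩
      exp x + 0                  ≡⟨ +-identityʳ (exp x) ⟩
      exp x                      ∎

  proj₂-⁻¹ : ∀ x → proj₂ (x ⁻¹) ≡ proj₂ x
  proj₂-⁻¹ (_ , false) = refl
  proj₂-⁻¹ (_ , true)  = refl

  ⁻¹-inverseˡ : ∀ x → x ⁻¹ · x ≡ e
  ⁻¹-inverseˡ x@(_ , ε) = SD-ext exp≈ (trans (cong (_xor ε) (proj₂-⁻¹ x)) (xor-same ε))
    where
    open ≈-Reasoning
    t = twist ε (exp x)
    exp≈ : exp (x ⁻¹ · x) ≈ exp e
    exp≈ = begin
      exp (x ⁻¹ · x)                         ≈⟨ exp-· (x ⁻¹) x ⟩
      exp (x ⁻¹) + twist (proj₂ (x ⁻¹)) (exp x) ≡⟨ cong (λ δ → exp (x ⁻¹) + twist δ (exp x)) (proj₂-⁻¹ x) ⟩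
      exp (x ⁻¹) + t                         ≈⟨ +-congʳ t (exp-⁻¹ x) ⟩
      M * t + t                              ≈⟨ M*t+t≈0 t ⟩
      0                                      ≈⟨ exp-e ⟨
      exp e                                  ∎

  ⁻¹-cancelˡ : ∀ x y → x ⁻¹ · (x · y) ≡ y
  ⁻¹-cancelˡ x y = trans (sym (·-assoc (x ⁻¹) x y)) (trans (cong (_· y) (⁻¹-inverseˡ x)) (·-identityˡ y))

  ⁻¹-cancelʳ : ∀ x y → y · x ⁻¹ · x ≡ y
  ⁻¹-cancelʳ x y = trans (·-assoc y (x ⁻¹) x) (trans (cong (y ·_) (⁻¹-inverseˡ x)) (·-identityʳ y))

  ⁻¹-involutive : ∀ x → x ⁻¹ ⁻¹ ≡ x
  ⁻¹-involutive x = begin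
    x ⁻¹ ⁻¹                ≡⟨ ·-identityʳ (x ⁻¹ ⁻¹) ⟨
    x ⁻¹ ⁻¹ · e            ≡⟨ cong (x ⁻¹ ⁻¹ ·_) (⁻¹-inverseˡ x) ⟨
    x ⁻¹ ⁻¹ · (x ⁻¹ · x)   ≡⟨ ⁻¹-cancelˡ (x ⁻¹) x ⟩
    x                      ∎
    where open ≡-Reasoning

  conj : SD n → SD n → SD n
  conj g x = g ⁻¹ · x · g

  conj-conj⁻¹ : ∀ g y → conj g (conj (g ⁻¹) y) ≡ y
  conj-conj⁻¹ g y = begin
    g ⁻¹ · (g ⁻¹ ⁻¹ · y · g ⁻¹) · g   ≡⟨ cong (λ h → g ⁻¹ · (h · y · g ⁻¹) · g) (⁻¹-involutive g) ⟩
    g ⁻¹ · (g · y · g ⁻¹) · g         ≡⟨ ·-assoc (g ⁻¹) (g · y · g ⁻¹) g ⟩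
    g ⁻¹ · (g · y · g ⁻¹ · g)         ≡⟨ cong (g ⁻¹ ·_) (⁻¹-cancelʳ g (g · y)) ⟩
    g ⁻¹ · (g · y)                    ≡⟨ ⁻¹-cancelˡ g y ⟩
    y                                 ∎
    where open ≡-Reasoning

  2∣N : 2 ∣ N n
  2∣N = divides (4 + 4 * q) (trans N≡ (poly q))
    where
    poly : ∀ q → 8 + 8 * q ≡ (4 + 4 * q) * 2
    poly = solve-∀

  twist-≈-mod2 : ∀ ε t → twist ε t Parity.≈ t
  twist-≈-mod2 false t = Parity.≈-refl
  twist-≈-mod2 true  t = Parity.≈-by-multiple ((1 + 2 * q) * t) (poly t q)
    where
    poly : ∀ t q → (3 + 4 * q) * t ≡ t + (1 + 2 * q) * t * 2
    poly = solve-∀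

  exp-·-mod2 : ∀ x y → exp (x · y) Parity.≈ exp x + exp y
  exp-·-mod2 x y = Parity.≈-trans (≈-weaken 2 (N n) 2∣N (exp-· x y))
                         (Parity.+-congˡ (exp x) (twist-≈-mod2 (proj₂ x) (exp y)))

  exp-conj-mod2 : ∀ g x → exp (conj g x) Parity.≈ exp x
  exp-conj-mod2 g x = begin
    exp (g ⁻¹ · x · g)                ≈⟨ exp-·-mod2 (g ⁻¹ · x) g ⟩
    exp (g ⁻¹ · x) + exp g            ≈⟨ Parity.+-congʳ (exp g) (exp-·-mod2 (g ⁻¹) x) ⟩
    exp (g ⁻¹) + exp x + exp g        ≡⟨ cong (_+ exp g) (+-comm (exp (g ⁻¹)) (exp x)) ⟩
    exp x + exp (g ⁻¹) + exp g        ≡⟨ +-assoc (exp x) _ _ ⟩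
    exp x + (exp (g ⁻¹) + exp g)      ≈⟨ Parity.+-congˡ (exp x) (exp-·-mod2 (g ⁻¹) g) ⟨
    exp x + exp (g ⁻¹ · g)            ≡⟨ cong (λ h → exp x + exp h) (⁻¹-inverseˡ g) ⟩
    exp x + exp e                     ≈⟨ Parity.+-congˡ (exp x) (≈-weaken 2 (N n) 2∣N exp-e) ⟩
    exp x + 0                         ≡⟨ +-identityʳ (exp x) ⟩
    exp x                             ∎
    where open Parity.≈-Reasoning

  proj₂-conj : ∀ g x → proj₂ (conj g x) ≡ proj₂ x
  proj₂-conj (_ , false) (_ , ε)     = xor-identityʳ ε
  proj₂-conj (_ , true)  (_ , false) = refl
  proj₂-conj (_ , true)  (_ , true)  = refl

  odd-conj : ∀ g x → odd (exp (conj g x)) ≡ odd (exp x)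
  odd-conj g x = cong (_≡ᵇ 1) (Parity.%-≡ (exp-conj-mod2 g x))

  exp-conj-rot : ∀ t x → exp (conj (rot t) x) ≈ M * t + exp x + twist (proj₂ x) t
  exp-conj-rot t x = begin
    exp (rot t ⁻¹ · x · rot t)
      ≈⟨ exp-· (rot t ⁻¹ · x) (rot t) ⟩
    exp (rot t ⁻¹ · x) + twist (proj₂ x) (exp (rot t))
      ≈⟨ +-cong (exp-· (rot t ⁻¹) x) (twist-cong (N n) (proj₂ x) (exp-modN t)) ⟩
    exp (rot t ⁻¹) + exp x + twist (proj₂ x) t
      ≈⟨ +-congʳ (twist (proj₂ x) t) (+-congʳ (exp x) (≈-trans (exp-⁻¹ (rot t)) (*-congˡ M (exp-modN t)))) ⟩
    M * t + exp x + twist (proj₂ x) t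
      ∎
    where open ≈-Reasoning

  conj-rot-rot : ∀ t i → conj (rot t) (i , false) ≡ (i , false)
  conj-rot-rot t i = SD-ext (≈-trans (exp-conj-rot t (i , false)) (≈-by-multiple′ t (poly t (toℕ i) q))) refl
    where
    poly : ∀ t i q → (7 + 8 * q) * t + i + t ≡ i + t * (8 + 8 * q)
    poly = solve-∀

  -- conjugation by a^t moves the exponent of a^i b by 2(1 + 2q)t, and (1 + 2q)² ≡ 1 modulo 4(1 + q)
  conj-rot-ref : ∀ h i → conj (rot (h * (1 + 2 * q))) (i , true) ≡ ref (toℕ i + 2 * h)
  conj-rot-ref h i = SD-ext exp≈ refl
    where
    open ≈-Reasoning
    t = h * (1 + 2 * q)
    poly : ∀ h i q → (7 + 8 * q) * (h * (1 + 2 * q)) + i + (3 + 4 * q) * (h * (1 + 2 * q))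
                     ≡ i + 2 * h + (1 + 3 * q) * h * (8 + 8 * q)
    poly = solve-∀
    exp≈ : exp (conj (rot t) (i , true)) ≈ exp (ref (toℕ i + 2 * h))
    exp≈ = begin
      exp (conj (rot t) (i , true))  ≈⟨ exp-conj-rot t (i , true) ⟩
      M * t + toℕ i + R * t         ≈⟨ ≈-by-multiple′ ((1 + 3 * q) * h) (poly h (toℕ i) q) ⟩
      toℕ i + 2 * h                 ≈⟨ exp-modN _ ⟨
      exp (ref (toℕ i + 2 * h))    ∎

  rot-·-rot : ∀ s t → rot s · rot t ≡ rot (s + t)
  rot-·-rot s t = SD-ext
    (≈-trans (exp-· (rot s) (rot t)) (≈-trans (+-cong (exp-modN s) (exp-modN t)) (≈-sym (exp-modN _)))) refl

  rot-·-ref : ∀ s t → rot s · ref t ≡ ref (s + t)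
  rot-·-ref s t = SD-ext
    (≈-trans (exp-· (rot s) (ref t)) (≈-trans (+-cong (exp-modN s) (exp-modN t)) (≈-sym (exp-modN _)))) refl

  ref-·-ref : ∀ s t → ref s · ref t ≡ rot (s + R * t)
  ref-·-ref s t = SD-ext
    (≈-trans (exp-· (ref s) (ref t)) (≈-trans (+-cong (exp-modN s) (*-congˡ R (exp-modN t))) (≈-sym (exp-modN _)))) refl

  ref-⁻¹ : ∀ t → ref t ⁻¹ ≡ ref (M * (R * t))
  ref-⁻¹ t = SD-ext
    (≈-trans (exp-⁻¹ (ref t)) (≈-trans (*-congˡ M (*-congˡ R (exp-modN t))) (≈-sym (exp-modN _)))) refl

  [1+R]*c≈0⇒even : ∀ c → (1 + R) * c ≈ 0 → odd c ≡ false
  [1+R]*c≈0⇒even c square≈0 with odd c | bit-odd c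
  ... | false | _  = refl
  ... | true  | c≡ = contradiction (≈-trans (≈-sym square≈half) square≈0) half≉0
    where
    square≈half : (1 + R) * c ≈ 4 + 4 * q
    square≈half = ≈-by-multiple′ (c / 2) (trans (cong ((1 + R) *_) c≡) (poly (c / 2) q))
      where
      poly : ∀ h q → (4 + 4 * q) * (1 + 2 * h) ≡ 4 + 4 * q + h * (8 + 8 * q)
      poly = solve-∀
    half<N : 4 + 4 * q < N n
    half<N = subst (4 + 4 * q <_) (sym N≡) (+-mono-<-≤ {4} {8} (s<s (s<s (s<s (s<s z<s)))) (*-monoˡ-≤ q (m≤m+n 4 4)))
    half≉0 : ¬ (4 + 4 * q ≈ 0)
    half≉0 (mk≈ half%N≡0%N) with () ← trans (sym (m<n⇒m%n≡m half<N)) (trans half%N≡0%N (m*n%n≡0 0 (N n)))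

  offset : Bool → ℕ → ℕ
  offset false c = 0
  offset true  c = c

  Cyc : (d : ℕ) .{{_ : NonZero d}} → Sub n
  Cyc d (i , false) = Congruence._≈ᵇ_ d (toℕ i) 0
  Cyc d (i , true)  = false

  Dih : (d : ℕ) .{{_ : NonZero d}} → ℕ → Sub n
  Dih d c (i , ε) = Congruence._≈ᵇ_ d (toℕ i) (offset ε c)

  module _ (d : ℕ) .{{_ : NonZero d}} (d∣N : d ∣ N n) where

    private module D = Congruence d

    ≈⇒≈ᵈ : ∀ {a b} → a ≈ b → a D.≈ b
    ≈⇒≈ᵈ = ≈-weaken d (N n) d∣N

    ∈Dih⇔ : ∀ {c} x → Mem n x (Dih d c) ⇔ exp x D.≈ offset (proj₂ x) c
    ∈Dih⇔ (i , ε) = D.≈ᵇ≡true⇔≈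

    -- (a^c b)² = a^((1 + r) c)
    Dih-isSubgroup : ∀ c → (1 + R) * c D.≈ 0 → IsSubgroup n (Dih d c)
    Dih-isSubgroup c square = ∈ᵈ e (≈⇒≈ᵈ exp-e) , ·-closed , ⁻¹-closed
      where
      open D.≈-Reasoning
      ∈ᵈ : ∀ x → exp x D.≈ offset (proj₂ x) c → Mem n x (Dih d c)
      ∈ᵈ x = Equivalence.from (∈Dih⇔ x)
      ∈ᵈ⁻ : ∀ {x} → Mem n x (Dih d c) → exp x D.≈ offset (proj₂ x) c
      ∈ᵈ⁻ {x} = Equivalence.to (∈Dih⇔ x)

      offset-· : ∀ ε δ → offset ε c + twist ε (offset δ c) D.≈ offset (ε xor δ) c
      offset-· false δ     = D.≈-refl
      offset-· true  false = D.≡⇒≈ (trans (cong (c +_) (*-zeroʳ R)) (+-identityʳ c))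
      offset-· true  true  = begin
        c + R * c       ≡⟨⟩
        (1 + R) * c     ≈⟨ square ⟩
        0               ∎

      offset-⁻¹ : ∀ ε → M * twist ε (offset ε c) D.≈ offset ε c
      offset-⁻¹ false = D.≡⇒≈ (*-zeroʳ M)
      offset-⁻¹ true  = begin
        M * (R * c)                          ≡⟨ poly c q ⟩
        c + (5 + 8 * q) * ((1 + R) * c)      ≈⟨ D.+-congˡ c (D.*-congˡ (5 + 8 * q) square) ⟩
        c + (5 + 8 * q) * 0                  ≡⟨ cong (c +_) (*-zeroʳ (5 + 8 * q)) ⟩
        c + 0                                ≡⟨ +-identityʳ c ⟩
        c                                    ∎
        where
        poly : ∀ c q → (7 + 8 * q) * ((3 + 4 * q) * c) ≡ c + (5 + 8 * q) * ((4 + 4 * q) * c)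
        poly = solve-∀

      ·-closed : ∀ x y → Mem n x (Dih d c) → Mem n y (Dih d c) → Mem n (x · y) (Dih d c)
      ·-closed x@(_ , ε) y@(_ , δ) x∈ y∈ = ∈ᵈ (x · y) (begin
        exp (x · y)                              ≈⟨ ≈⇒≈ᵈ (exp-· x y) ⟩
        exp x + twist ε (exp y)                  ≈⟨ D.+-cong (∈ᵈ⁻ x∈) (twist-cong d ε (∈ᵈ⁻ y∈)) ⟩
        offset ε c + twist ε (offset δ c)        ≈⟨ offset-· ε δ ⟩
        offset (ε xor δ) c                       ∎)

      ⁻¹-closed : ∀ x → Mem n x (Dih d c) → Mem n (x ⁻¹) (Dih d c)
      ⁻¹-closed x@(_ , ε) x∈ = ∈ᵈ (x ⁻¹) (begin
        exp (x ⁻¹)                     ≈⟨ ≈⇒≈ᵈ (exp-⁻¹ x) ⟩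
        M * twist ε (exp x)            ≈⟨ D.*-congˡ M (twist-cong d ε (∈ᵈ⁻ x∈)) ⟩
        M * twist ε (offset ε c)       ≈⟨ offset-⁻¹ ε ⟩
        offset ε c                     ≡⟨ cong (λ δ → offset δ c) (proj₂-⁻¹ x) ⟨
        offset (proj₂ (x ⁻¹)) c        ∎)

    Cyc-isSubgroup : IsSubgroup n (Cyc d)
    Cyc-isSubgroup = e∈ , ·-closed , ⁻¹-closed
      where
      Dih₀ = Dih-isSubgroup 0 (D.≡⇒≈ (*-zeroʳ (1 + R)))
      e∈ = proj₁ Dih₀
      ·-closed : ∀ x y → Mem n x (Cyc d) → Mem n y (Cyc d) → Mem n (x · y) (Cyc d)
      ·-closed (i , false) (j , false) = proj₁ (proj₂ Dih₀) (i , false) (j , false)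
      ·-closed (i , false) (j , true)  _ ()
      ·-closed (i , true)  y           ()
      ⁻¹-closed : ∀ x → Mem n x (Cyc d) → Mem n (x ⁻¹) (Cyc d)
      ⁻¹-closed (i , false) = proj₂ (proj₂ Dih₀) (i , false)
      ⁻¹-closed (i , true)  ()

  order-split : ∀ H → order n H ≡ count (H ∘ rot) (N n) + count (H ∘ ref) (N n)
  order-split H = begin
    length (filterᵇ H (rots ++ refls))                    ≡⟨ cong length (filter-++ (T? ∘ H) rots refls) ⟩
    length (filterᵇ H rots ++ filterᵇ H refls)            ≡⟨ length-++ (filterᵇ H rots) ⟩
    length (filterᵇ H rots) + length (filterᵇ H refls)    ≡⟨ cong₂ _+_ (half false) (half true) ⟩
    count (H ∘ rot) (N n) + count (H ∘ ref) (N n)        ∎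
    where
    open ≡-Reasoning
    rots = map (_, false) (allFin (N n))
    refls = map (_, true) (allFin (N n))
    half : ∀ ε → length (filterᵇ H (map (_, ε) (allFin (N n)))) ≡ count (λ t → H (modN n t , ε)) (N n)
    half ε = trans (cong (length ∘ filterᵇ H) (map-tabulate (λ i → i) (_, ε)))
      (length-filterᵇ-tabulate (N n) (_, ε) H _ (λ i → cong (λ j → H (j , ε)) (sym (modN-toℕ i))))

  count-residue-modN : ∀ d .{{_ : NonZero d}} u c → N n ≡ u * d →
    count (λ t → Congruence._≈ᵇ_ d (toℕ (modN n t)) c) (N n) ≡ u
  count-residue-modN d u c N≡ud = begin
    count (λ t → toℕ (modN n t) % d ≡ᵇ c % d) (N n)
      ≡⟨ count-cong (N n) (λ t<N → cong (λ m → m % d ≡ᵇ c % d) (toℕ-modN< t<N)) ⟩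
    count (λ t → t % d ≡ᵇ c % d) (N n)                ≡⟨ cong (count _) N≡ud ⟩
    count (λ t → t % d ≡ᵇ c % d) (u * d)              ≡⟨ count-residue u d c ⟩
    u                                                  ∎
    where
    open ≡-Reasoning
    toℕ-modN< : ∀ {t} → t < N n → toℕ (modN n t) ≡ t
    toℕ-modN< t<N = trans (toℕ-modN _) (m<n⇒m%n≡m t<N)

  order-Cyc : ∀ d .{{_ : NonZero d}} u → N n ≡ u * d → order n (Cyc d) ≡ u
  order-Cyc d u N≡ud = trans (order-split (Cyc d))
    (trans (cong₂ _+_ (count-residue-modN d u 0 N≡ud) (count-false (N n))) (+-identityʳ u))

  order-Dih : ∀ d .{{_ : NonZero d}} u c → N n ≡ u * d → order n (Dih d c) ≡ u + u
  order-Dih d u c N≡ud = trans (order-split (Dih d c))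
    (cong₂ _+_ (count-residue-modN d u 0 N≡ud) (count-residue-modN d u c N≡ud))

  module _ {d d′ : ℕ} .{{_ : NonZero d}} .{{_ : NonZero d′}} (d′∣d : d′ ∣ d) where

    private
      ≈ᵇ-weaken : ∀ {a b} → Congruence._≈ᵇ_ d a b ≡ true → Congruence._≈ᵇ_ d′ a b ≡ true
      ≈ᵇ-weaken = Equivalence.from (Congruence.≈ᵇ≡true⇔≈ d′) ∘ ≈-weaken d′ d d′∣d
                ∘ Equivalence.to (Congruence.≈ᵇ≡true⇔≈ d)

    Cyc⊆Cyc : Included n (Cyc d) (Cyc d′)
    Cyc⊆Cyc (i , false) = ≈ᵇ-weaken
    Cyc⊆Cyc (i , true)  ()

    Cyc⊆Dih : ∀ {c} → Included n (Cyc d) (Dih d′ c)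
    Cyc⊆Dih (i , false) = ≈ᵇ-weaken
    Cyc⊆Dih (i , true)  ()

    Dih⊆Dih : ∀ {c} → Included n (Dih d c) (Dih d′ c)
    Dih⊆Dih (i , ε) = ≈ᵇ-weaken

  conj-Cyc : ∀ d .{{_ : NonZero d}} t → SameSub n (conjSub n (rot t) (Cyc d)) (Cyc d)
  conj-Cyc d t (i , false) = cong (Cyc d) (conj-rot-rot t i)
  conj-Cyc d t (i , true)  = refl

  conj-Dih : ∀ d .{{_ : NonZero d}} → d ∣ N n → ∀ ε h c → c ≡ bit ε + 2 * h →
    SameSub n (conjSub n (rot (h * (1 + 2 * q))) (Dih d c)) (Dih d (bit ε))
  conj-Dih d d∣N ε h c c≡ (i , false) = cong (Dih d c) (conj-rot-rot _ i)
  conj-Dih d d∣N ε h c c≡ (i , true)  = trans (cong (Dih d c) (conj-rot-ref h i))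
    (≡true⇔⇒≡ (⇔-trans D.≈ᵇ≡true⇔≈ (mk⇔ ⇒ ⇐)) D.≈ᵇ≡true⇔≈)
    where
    module D = Congruence d
    shifted : toℕ (modN n (toℕ i + 2 * h)) D.≈ toℕ i + 2 * h
    shifted = ≈-weaken d (N n) d∣N (exp-modN _)
    ⇒ : toℕ (modN n (toℕ i + 2 * h)) D.≈ c → toℕ i D.≈ bit ε
    ⇒ i′≈c = D.+-cancelʳ (2 * h) (D.≈-trans (D.≈-sym shifted) (D.≈-trans i′≈c (D.≡⇒≈ c≡)))
    ⇐ : toℕ i D.≈ bit ε → toℕ (modN n (toℕ i + 2 * h)) D.≈ c
    ⇐ i≈ε = D.≈-trans shifted (D.≈-trans (D.+-congʳ (2 * h) i≈ε) (D.≡⇒≈ (sym c≡)))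

  module Structure (H : Sub n) (H≤G : IsSubgroup n H) where

    Rot Ref : ℕ → Bool
    Rot t = H (rot t)
    Ref t = H (ref t)

    private
      e∈H = proj₁ H≤G
      ·-closed = proj₁ (proj₂ H≤G)
      ⁻¹-closed = proj₂ (proj₂ H≤G)

      ∈H : ∀ {x y} → x ≡ y → Mem n x H → Mem n y H
      ∈H x≡y = subst (λ z → Mem n z H) x≡y

    Rot-+ : ∀ {s t} → Rot s ≡ true → Rot t ≡ true → Rot (s + t) ≡ true
    Rot-+ {s} {t} s∈ t∈ = ∈H (rot-·-rot s t) (·-closed _ _ s∈ t∈)

    Rot-cong : ∀ {s t} → s ≈ t → Rot s ≡ Rot t
    Rot-cong s≈t = cong (λ i → H (i , false)) (modN-cong s≈t)

    Ref-cong : ∀ {s t} → s ≈ t → Ref s ≡ Ref t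
    Ref-cong s≈t = cong (λ i → H (i , true)) (modN-cong s≈t)

    open AdditiveSubmonoid (N n) Rot Rot-cong e∈H Rot-+ public
    private module P = Congruence period

    ≈⇒≈ₚ : ∀ {a b} → a ≈ b → a P.≈ b
    ≈⇒≈ₚ = ≈-weaken period (N n) period∣N

    Ref⇔ : ∀ {c} → Ref c ≡ true → ∀ x → Ref x ≡ true ⇔ x P.≈ c
    Ref⇔ {c} c∈ x = mk⇔ ⇒ ⇐
      where
      open P.≈-Reasoning
      c+Mc≈0 : c + M * c P.≈ 0
      c+Mc≈0 = ≈⇒≈ₚ (≈-trans (≡⇒≈ (+-comm c (M * c))) (M*t+t≈0 c))
      ⇒ : Ref x ≡ true → x P.≈ c
      ⇒ x∈ = P.+-cancelʳ (M * c) (begin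
        x + M * c                   ≈⟨ ≈⇒≈ₚ (+-congˡ x R*M*R≈M) ⟨
        x + R * (M * (R * c))       ≈⟨ S⇒≈0 (∈H x·c⁻¹≡ (·-closed _ _ x∈ (⁻¹-closed _ c∈))) ⟩
        0                           ≈⟨ c+Mc≈0 ⟨
        c + M * c                   ∎)
        where
        x·c⁻¹≡ : ref x · ref c ⁻¹ ≡ rot (x + R * (M * (R * c)))
        x·c⁻¹≡ = trans (cong (ref x ·_) (ref-⁻¹ c)) (ref-·-ref x _)
        R*M*R≈M : R * (M * (R * c)) ≈ M * c
        R*M*R≈M = ≈-trans (≡⇒≈ (poly c q)) (*-congˡ M (R*R≈1 c))
          where
          poly : ∀ c q → (3 + 4 * q) * ((7 + 8 * q) * ((3 + 4 * q) * c))
                         ≡ (7 + 8 * q) * ((3 + 4 * q) * ((3 + 4 * q) * c))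
          poly = solve-∀
      ⇐ : x P.≈ c → Ref x ≡ true
      ⇐ x≈c = trans (Ref-cong (≈-sym x+Mc+c≈x)) (∈H (rot-·-ref (x + M * c) c) (·-closed _ _ (≈0⇒S x+Mc≈0) c∈))
        where
        x+Mc≈0 : x + M * c P.≈ 0
        x+Mc≈0 = P.≈-trans (P.+-congʳ (M * c) x≈c) c+Mc≈0
        x+Mc+c≈x : x + M * c + c ≈ x
        x+Mc+c≈x = ≈-by-multiple′ c (poly x c q)
          where
          poly : ∀ x c q → x + (7 + 8 * q) * c + c ≡ x + c * (8 + 8 * q)
          poly = solve-∀

    H-rot : ∀ i → H (i , false) ≡ Rot (toℕ i)
    H-rot i = cong (λ j → H (j , false)) (sym (modN-toℕ i))

    H-ref : ∀ i → H (i , true) ≡ Ref (toℕ i)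
    H-ref i = cong (λ j → H (j , true)) (sym (modN-toℕ i))

    NoReflection : Set
    NoReflection = ∀ c → Ref c ≡ false

    H≅Cyc : NoReflection → SameSub n H (Cyc period)
    H≅Cyc no-ref (i , false) = trans (H-rot i) (S≡≈ᵇ0 (toℕ i))
    H≅Cyc no-ref (i , true)  = trans (H-ref i) (no-ref (toℕ i))

    H≅Dih : ∀ {c} → Ref c ≡ true → SameSub n H (Dih period c)
    H≅Dih c∈ (i , false) = trans (H-rot i) (S≡≈ᵇ0 (toℕ i))
    H≅Dih c∈ (i , true)  = trans (H-ref i) (≡true⇔⇒≡ (Ref⇔ c∈ (toℕ i)) P.≈ᵇ≡true⇔≈)

    reflection? : NoReflection ⊎ ∃[ c ] Ref c ≡ true
    reflection? with anyUpTo? (T? ∘ Ref) (N n)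
    ... | yes (c , _ , c∈) = inj₂ (c , Equivalence.to T-≡ c∈)
    ... | no ∄c            = inj₁ λ c → trans (Ref-cong (≈-sym (%-≈ c))) (no-ref-below (m%n<n c (N n)))
      where
      no-ref-below : ∀ {c} → c < N n → Ref c ≡ false
      no-ref-below {c} c<N with Ref c in c∈
      ... | true  = contradiction (c , c<N , Equivalence.from T-≡ c∈) ∄c
      ... | false = refl

  2^≢0 : ∀ m → NonZero (2 ^ m)
  2^≢0 m = m^n≢0 2 m

  cyclic : ℕ → Sub n
  cyclic j = Cyc (2 ^ (n ∸ 1 ∸ j)) {{2^≢0 (n ∸ 1 ∸ j)}}

  dihedral : ℕ → Bool → Sub n
  dihedral k ε = Dih (2 ^ (n ∸ k)) {{2^≢0 (n ∸ k)}} (bit ε)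

  N≡2^j*2^[n-1-j] : ∀ {j} → j ≤ n ∸ 1 → N n ≡ 2 ^ j * 2 ^ (n ∸ 1 ∸ j)
  N≡2^j*2^[n-1-j] {j} j≤ = trans (cong (2 ^_) (sym (m+[n∸m]≡n j≤))) (^-distribˡ-+-* 2 j _)

  cyclic-isSubgroup : ∀ j → IsSubgroup n (cyclic j)
  cyclic-isSubgroup j = Cyc-isSubgroup (2 ^ (n ∸ 1 ∸ j)) {{2^≢0 (n ∸ 1 ∸ j)}} (^-monoʳ-∣ 2 (m∸n≤m (n ∸ 1) j))

  order-cyclic : ∀ {j} → j < n → order n (cyclic j) ≡ 2 ^ j
  order-cyclic {j} (s≤s j≤) = order-Cyc (2 ^ (n ∸ 1 ∸ j)) {{2^≢0 (n ∸ 1 ∸ j)}} (2 ^ j) (N≡2^j*2^[n-1-j] j≤)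

  dihedral-isSubgroup : ∀ {k} ε → 1 ≤ k → (T ε → 2 ≤ k) → IsSubgroup n (dihedral k ε)
  dihedral-isSubgroup {k} ε 1≤k 2≤k =
    Dih-isSubgroup (2 ^ (n ∸ k)) {{2^≢0 (n ∸ k)}} (^-monoʳ-∣ 2 (∸-monoʳ-≤ n 1≤k)) (bit ε) (square ε 2≤k)
    where
    instance _ = 2^≢0 (n ∸ k)
    module D = Congruence (2 ^ (n ∸ k))
    square : ∀ ε → (T ε → 2 ≤ k) → (1 + R) * bit ε D.≈ 0
    square false _   = D.≡⇒≈ (*-zeroʳ (1 + R))
    square true  2≤k = D.mk≈ (trans (n∣m⇒m%n≡0 _ _ 2^[n-k]∣[1+R]*1) (sym (m*n%n≡0 0 (2 ^ (n ∸ k)))))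
      where
      2^[n-k]∣[1+R]*1 : 2 ^ (n ∸ k) ∣ (1 + R) * 1
      2^[n-k]∣[1+R]*1 = subst (2 ^ (n ∸ k) ∣_) (trans (sym 1+R≡2^[n-2]) (sym (*-identityʳ (1 + R))))
                               (^-monoʳ-∣ 2 (∸-monoʳ-≤ n (2≤k _)))

  order-dihedral : ∀ {k} ε → 1 ≤ k → k ≤ n → order n (dihedral k ε) ≡ 2 ^ k
  order-dihedral {suc k} ε _ (s≤s k≤) =
    trans (order-Dih (2 ^ (n ∸ suc k)) {{2^≢0 (n ∸ suc k)}} (2 ^ k) (bit ε) (N≡2^j*2^[n-1-j] k≤))
          (cong (2 ^ k +_) (sym (+-identityʳ (2 ^ k))))

  order-cong : ∀ {H K} → SameSub n H K → order n H ≡ order n K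
  order-cong {H} {K} H≡K =
    cong length (filter-≐ (T? ∘ H) (T? ∘ K) (subst T (H≡K _) , subst T (sym (H≡K _))) (elems n))

  Cyc-cong : ∀ {d d′} .{{_ : NonZero d}} .{{_ : NonZero d′}} → d ≡ d′ → SameSub n (Cyc d) (Cyc d′)
  Cyc-cong refl (i , false) = refl
  Cyc-cong refl (i , true)  = refl

  Dih-cong : ∀ {d d′} .{{_ : NonZero d}} .{{_ : NonZero d′}} c → d ≡ d′ → SameSub n (Dih d c) (Dih d′ c)
  Dih-cong c refl x = refl

  module _ {H : Sub n} (H≤G : IsSubgroup n H) where

    private
      module S = Structure H H≤G
      u = quotient S.period∣N
      N≡u*period : N n ≡ u * S.period
      N≡u*period = m∣n⇒n≡quotient*m S.period∣N

    cyclic-normalForm : ∀ j → S.NoReflection → order n H ≡ 2 ^ j → j < n × SameSub n H (cyclic j)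
    cyclic-normalForm j no-ref |H| = s≤s j≤n-1 , λ x → trans (S.H≅Cyc no-ref x) (Cyc-cong period≡ x)
      where
      instance _ = 2^≢0 (n ∸ 1 ∸ j)
      u≡2^j : u ≡ 2 ^ j
      u≡2^j = trans (sym (order-Cyc S.period u N≡u*period)) (trans (sym (order-cong (S.H≅Cyc no-ref))) |H|)
      factor = ^-factor {2} {n ∸ 1} {j} (s≤s (s≤s z≤n)) (trans N≡u*period (cong (_* S.period) u≡2^j))
      j≤n-1 = proj₁ factor
      period≡ = proj₂ factor

    dihedral-normalForm : ∀ k {c} → S.Ref c ≡ true → order n H ≡ 2 ^ k →
      1 ≤ k × k ≤ n × SameSub n H (Dih (2 ^ (n ∸ k)) {{2^≢0 (n ∸ k)}} c)
    dihedral-normalForm k {c} c∈ |H| = from-order k u+u≡2^k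
      where
      u+u≡2^k : u + u ≡ 2 ^ k
      u+u≡2^k = trans (sym (order-Dih S.period u c N≡u*period)) (trans (sym (order-cong (S.H≅Dih c∈))) |H|)
      from-order : ∀ k → u + u ≡ 2 ^ k → 1 ≤ k × k ≤ n × SameSub n H (Dih (2 ^ (n ∸ k)) {{2^≢0 (n ∸ k)}} c)
      from-order zero    u+u≡1   = contradiction (trans (cong (u +_) (+-identityʳ u)) u+u≡1) (even≢odd u 0)
      from-order (suc k) u+u≡2^k = s≤s z≤n , s≤s k≤n-1 , λ x → trans (S.H≅Dih c∈ x) (Dih-cong c period≡ x)
        where
        instance _ = 2^≢0 (n ∸ suc k)
        u≡2^k : u ≡ 2 ^ k
        u≡2^k = *-cancelˡ-≡ u (2 ^ k) 2 (trans (cong (u +_) (+-identityʳ u)) u+u≡2^k)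
        factor = ^-factor {2} {n ∸ 1} {k} (s≤s (s≤s z≤n)) (trans N≡u*period (cong (_* S.period) u≡2^k))
        k≤n-1 = proj₁ factor
        period≡ = proj₂ factor

  cyclic⊆cyclic : ∀ {j k} → j ≤ k → Included n (cyclic j) (cyclic k)
  cyclic⊆cyclic {j} {k} j≤k =
    Cyc⊆Cyc {{2^≢0 (n ∸ 1 ∸ j)}} {{2^≢0 (n ∸ 1 ∸ k)}} (^-monoʳ-∣ 2 (∸-monoʳ-≤ (n ∸ 1) j≤k))

  cyclic⊆dihedral : ∀ {j k} ε → j < k → Included n (cyclic j) (dihedral k ε)
  cyclic⊆dihedral {j} {k} ε j<k = Cyc⊆Dih {{2^≢0 (n ∸ 1 ∸ j)}} {{2^≢0 (n ∸ k)}} (^-monoʳ-∣ 2 (∸-monoʳ-≤ n j<k))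

  dihedral⊆dihedral : ∀ {j k} ε → j ≤ k → Included n (dihedral j ε) (dihedral k ε)
  dihedral⊆dihedral {j} {k} ε j≤k = Dih⊆Dih {{2^≢0 (n ∸ j)}} {{2^≢0 (n ∸ k)}} (^-monoʳ-∣ 2 (∸-monoʳ-≤ n j≤k))

  data Shape : Set where
    cyc-cyc         : Shape
    cyc-dih dih-dih : Bool → Shape

  pairRep : ℕ → ℕ → Shape → Sub n × Sub n
  pairRep j k cyc-cyc     = cyclic j , cyclic k
  pairRep j k (cyc-dih ε) = cyclic j , dihedral k ε
  pairRep j k (dih-dih ε) = dihedral j ε , dihedral k ε

  Admissible : ℕ → ℕ → Shape → Set
  Admissible j k cyc-cyc     = k < n
  Admissible j k (cyc-dih ε) = T ε → 2 ≤ k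
  Admissible j k (dih-dih ε) = 1 ≤ j × (T ε → 2 ≤ j)

  ⊊-by-order : ∀ {j k H K} → j < k → order n H ≡ 2 ^ j → order n K ≡ 2 ^ k → ¬ SameSub n H K
  ⊊-by-order j<k |H| |K| H≡K =
    <-irrefl (trans (sym |H|) (trans (order-cong H≡K) |K|)) (^-monoʳ-< 2 (s≤s (s≤s z≤n)) j<k)

  pairRep-isPair : ∀ {j k} s → j < k → k ≤ n → Admissible j k s → IsPair n j k (pairRep j k s)
  pairRep-isPair {j} {k} cyc-cyc j<k _ k<n =
    cyclic-isSubgroup j , cyclic-isSubgroup k ,
    cyclic⊆cyclic (<⇒≤ j<k) ,
    ⊊-by-order j<k (order-cyclic j<n) (order-cyclic k<n) , order-cyclic j<n , order-cyclic k<n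
    where j<n = <-trans j<k k<n
  pairRep-isPair {j} {k} (cyc-dih ε) j<k k≤n 2≤k =
    cyclic-isSubgroup j , dihedral-isSubgroup ε 1≤k 2≤k ,
    cyclic⊆dihedral ε j<k ,
    ⊊-by-order j<k (order-cyclic (<-≤-trans j<k k≤n)) (order-dihedral ε 1≤k k≤n) ,
    order-cyclic (<-≤-trans j<k k≤n) , order-dihedral ε 1≤k k≤n
    where 1≤k = ≤-trans (s≤s z≤n) j<k
  pairRep-isPair {j} {k} (dih-dih ε) j<k k≤n (1≤j , 2≤j) =
    dihedral-isSubgroup ε 1≤j 2≤j , dihedral-isSubgroup ε 1≤k (λ t → ≤-trans (2≤j t) (<⇒≤ j<k)) ,
    dihedral⊆dihedral ε (<⇒≤ j<k) ,
    ⊊-by-order j<k (order-dihedral ε 1≤j j≤n) (order-dihedral ε 1≤k k≤n) ,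
    order-dihedral ε 1≤j j≤n , order-dihedral ε 1≤k k≤n
    where
    j≤n = <⇒≤ (<-≤-trans j<k k≤n)
    1≤k = ≤-trans 1≤j (<⇒≤ j<k)

  rotation-conj : ∀ {H} (H≤G : IsSubgroup n H) j → Structure.NoReflection H H≤G → order n H ≡ 2 ^ j →
    ∀ t → SameSub n (cyclic j) (conjSub n (rot t) H)
  rotation-conj H≤G j no-ref |H| t x =
    sym (trans (H≅ (conj (rot t) x)) (conj-Cyc (2 ^ (n ∸ 1 ∸ j)) {{2^≢0 (n ∸ 1 ∸ j)}} t x))
    where H≅ = proj₂ (cyclic-normalForm H≤G j no-ref |H|)

  conjugator : ℕ → SD n
  conjugator c = rot (c / 2 * (1 + 2 * q))

  reflection-conj : ∀ {H} (H≤G : IsSubgroup n H) k {c} → Structure.Ref H H≤G c ≡ true → order n H ≡ 2 ^ k →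
    SameSub n (dihedral k (odd c)) (conjSub n (conjugator c) H)
  reflection-conj H≤G k {c} c∈H |H| x = sym (trans (H≅ (conj (conjugator c) x))
    (conj-Dih (2 ^ (n ∸ k)) {{2^≢0 (n ∸ k)}} (^-monoʳ-∣ 2 (∸-monoʳ-≤ n 1≤k)) (odd c) (c / 2) c (bit-odd c) x))
    where
    normalForm = dihedral-normalForm H≤G k c∈H |H|
    1≤k = proj₁ normalForm
    H≅ = proj₂ (proj₂ normalForm)

  odd-reflection⇒2≤k : ∀ {H} (H≤G : IsSubgroup n H) k {c} → Structure.Ref H H≤G c ≡ true → order n H ≡ 2 ^ k →
    T (odd c) → 2 ≤ k
  odd-reflection⇒2≤k {H} H≤G k {c} c∈H |H| odd-c = from-normalForm k (dihedral-normalForm H≤G k c∈H |H|)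
    where
    from-normalForm : ∀ k → 1 ≤ k × k ≤ n × SameSub n H (Dih (2 ^ (n ∸ k)) {{2^≢0 (n ∸ k)}} c) → 2 ≤ k
    from-normalForm (suc (suc _)) _ = s≤s (s≤s z≤n)
    from-normalForm 1 (_ , _ , H≅) =
      contradiction ([1+R]*c≈0⇒even c square≈0) (λ even-c → subst T even-c odd-c)
      where
      square∈H : H (rot ((1 + R) * c)) ≡ true
      square∈H = subst (λ x → H x ≡ true) (ref-·-ref c c) (proj₁ (proj₂ H≤G) _ _ c∈H c∈H)
      square≈0 : (1 + R) * c ≈ 0
      square≈0 = ≈-trans (≈-sym (exp-modN _)) (Equivalence.to ≈ᵇ≡true⇔≈ (trans (sym (H≅ _)) square∈H))

  classifyPair : ∀ {j k P} → IsPair n j k P → ∃[ s ] (Admissible j k s × ConjPair n P (pairRep j k s))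
  classifyPair {j} {k} {H , K} (H≤G , K≤G , H⊆K , _ , |H| , |K|) =
    by-reflections (Structure.reflection? H H≤G) (Structure.reflection? K K≤G)
    where
    module SH = Structure H H≤G
    module SK = Structure K K≤G
    by-reflections : SH.NoReflection ⊎ ∃[ c ] SH.Ref c ≡ true → SK.NoReflection ⊎ ∃[ c ] SK.Ref c ≡ true →
                     ∃[ s ] (Admissible j k s × ConjPair n (H , K) (pairRep j k s))
    by-reflections (inj₂ (c , c∈H)) _ =
      dih-dih (odd c) , (proj₁ (dihedral-normalForm H≤G j c∈H |H|) , odd-reflection⇒2≤k H≤G j c∈H |H|) ,
      conjugator c , reflection-conj H≤G j c∈H |H| , reflection-conj K≤G k (H⊆K (ref c) c∈H) |K|
    by-reflections (inj₁ H-rotations) (inj₁ K-rotations) =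
      cyc-cyc , proj₁ (cyclic-normalForm K≤G k K-rotations |K|) ,
      rot 0 , rotation-conj H≤G j H-rotations |H| 0 , rotation-conj K≤G k K-rotations |K| 0
    by-reflections (inj₁ H-rotations) (inj₂ (c , c∈K)) =
      cyc-dih (odd c) , odd-reflection⇒2≤k K≤G k c∈K |K| ,
      conjugator c , rotation-conj H≤G j H-rotations |H| _ , reflection-conj K≤G k c∈K |K|

  HasReflection : Sub n → Bool → Set
  HasReflection S ε = ∃[ x ] (Mem n x S × proj₂ x ≡ true × odd (exp x) ≡ ε)

  HasReflection-conj : ∀ {S S′} g → SameSub n S′ (conjSub n g S) → ∀ ε → HasReflection S′ ε ⇔ HasReflection S ε
  HasReflection-conj {S} {S′} g S′≅ ε = mk⇔
    (λ (x , x∈ , x-ref , x-odd) →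
      conj g x , trans (sym (S′≅ x)) x∈ , trans (proj₂-conj g x) x-ref , trans (odd-conj g x) x-odd)
    (λ (y , y∈ , y-ref , y-odd) →
      conj (g ⁻¹) y , trans (S′≅ _) (trans (cong S (conj-conj⁻¹ g y)) y∈) ,
      trans (proj₂-conj (g ⁻¹) y) y-ref , trans (odd-conj (g ⁻¹) y) y-odd)

  Profile : Sub n → Bool × Bool → Set
  Profile S (b₀ , b₁) = Reflects (HasReflection S false) b₀ × Reflects (HasReflection S true) b₁

  profile-conj : ∀ {S S′ π π′} g → SameSub n S′ (conjSub n g S) → Profile S′ π′ → Profile S π → π′ ≡ π
  profile-conj g S′≅ (r₀′ , r₁′) (r₀ , r₁) =
    cong₂ _,_ (det (Reflects-⇔ (HasReflection-conj g S′≅ false) r₀′) r₀)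
              (det (Reflects-⇔ (HasReflection-conj g S′≅ true) r₁′) r₁)

  profile-Cyc : ∀ d .{{_ : NonZero d}} → Profile (Cyc d) (false , false)
  profile-Cyc d = ofⁿ no-reflection , ofⁿ no-reflection
    where
    no-reflection : ∀ {ε} → ¬ HasReflection (Cyc d) ε
    no-reflection ((i , true) , () , _)

  odd-ref : ∀ c → odd (exp (ref c)) ≡ odd c
  odd-ref c = cong (_≡ᵇ 1) (Parity.%-≡ (≈-weaken 2 (N n) 2∣N (exp-modN c)))

  odd-bit : ∀ ε → odd (bit ε) ≡ ε
  odd-bit false = refl
  odd-bit true  = refl

  module _ (d : ℕ) .{{_ : NonZero d}} (d∣N : d ∣ N n) where

    private module D = Congruence d

    ref∈Dih : ∀ c → Mem n (ref c) (Dih d c)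
    ref∈Dih c = Equivalence.from D.≈ᵇ≡true⇔≈ (≈-weaken d (N n) d∣N (exp-modN c))

    HasReflection-Dih : ∀ c ε → 2 ∣ d → HasReflection (Dih d c) ε ⇔ odd c ≡ ε
    HasReflection-Dih c ε 2∣d = mk⇔
      (λ { ((i , true) , i∈ , _ , i-odd) →
             trans (cong (_≡ᵇ 1) (sym (Parity.%-≡ (≈-weaken 2 d 2∣d (Equivalence.to D.≈ᵇ≡true⇔≈ i∈))))) i-odd })
      (λ c-odd → ref c , ref∈Dih c , refl , trans (odd-ref c) c-odd)

  profile-dihedral : ∀ {k} ε → 1 ≤ k → k < n → Profile (dihedral k ε) (not ε , ε)
  profile-dihedral {k} ε 1≤k k<n =
    Reflects-⇔ (⇔-sym (has ε false)) (bit-reflects ε false) , Reflects-⇔ (⇔-sym (has ε true)) (bit-reflects ε true)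
    where
    has = λ ε ε′ → HasReflection-Dih (2 ^ (n ∸ k)) {{2^≢0 (n ∸ k)}} (^-monoʳ-∣ 2 (∸-monoʳ-≤ n 1≤k)) (bit ε) ε′
                     (^-monoʳ-∣ 2 {1} (m<n⇒0<n∸m k<n))
    bit-reflects : ∀ ε ε′ → Reflects (odd (bit ε) ≡ ε′) (if ε′ then ε else not ε)
    bit-reflects false false = ofʸ refl
    bit-reflects false true  = ofⁿ λ ()
    bit-reflects true  false = ofⁿ λ ()
    bit-reflects true  true  = ofʸ refl

  dihedral-top≅Dih1 : ∀ ε → SameSub n (dihedral n ε) (Dih 1 0)
  dihedral-top≅Dih1 ε x@(i , δ) = trans (Dih-cong {{2^≢0 (n ∸ n)}} (bit ε) (cong (2 ^_) (n∸n≡0 n)) x)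
    (cong (toℕ i % 1 ≡ᵇ_) (trans (n%1≡0 (offset δ (bit ε))) (sym (n%1≡0 (offset δ 0)))))

  profile-top : ∀ ε → Profile (dihedral n ε) (true , true)
  profile-top ε = ofʸ (has false) , ofʸ (has true)
    where
    has : ∀ ε′ → HasReflection (dihedral n ε) ε′
    has ε′ = ref (bit ε′) ,
             trans (dihedral-top≅Dih1 ε (ref (bit ε′))) (cong₂ _≡ᵇ_ (n%1≡0 (toℕ (modN n (bit ε′)))) (n%1≡0 0)) ,
             refl , trans (odd-ref (bit ε′)) (odd-bit ε′)

  Signature : Set
  Signature = (Bool × Bool) × (Bool × Bool)

  _≟ˢ_ : DecidableEquality Signature
  _≟ˢ_ = ≡-dec (≡-dec Bool._≟_ Bool._≟_) (≡-dec Bool._≟_ Bool._≟_)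

  PairProfile : Sub n × Sub n → Signature → Set
  PairProfile (H , K) (π , σ) = Profile H π × Profile K σ

  pairProfile-conj : ∀ {P P′ s s′} → ConjPair n P P′ → PairProfile P s → PairProfile P′ s′ → s′ ≡ s
  pairProfile-conj (g , H′≅ , K′≅) (πH , πK) (πH′ , πK′) =
    cong₂ _,_ (profile-conj g H′≅ πH′ πH) (profile-conj g K′≅ πK′ πK)

  Top : Bool → ℕ → Set
  Top false k = k < n
  Top true  k = k ≡ n

  Top⇒≤ : ∀ {top k} → Top top k → k ≤ n
  Top⇒≤ {false} k<n  = <⇒≤ k<n
  Top⇒≤ {true}  refl = ≤-refl

  dihProfile : Bool → Bool → Bool × Bool
  dihProfile false ε = not ε , ε
  dihProfile true  ε = true , true

  shapeProfile : Bool → Shape → Signature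
  shapeProfile top cyc-cyc     = (false , false) , (false , false)
  shapeProfile top (cyc-dih ε) = (false , false) , dihProfile top ε
  shapeProfile top (dih-dih ε) = dihProfile false ε , dihProfile top ε

  profile-cyclic : ∀ j → Profile (cyclic j) (false , false)
  profile-cyclic j = profile-Cyc (2 ^ (n ∸ 1 ∸ j)) {{2^≢0 (n ∸ 1 ∸ j)}}

  profile-dihedral′ : ∀ {k} top ε → 1 ≤ k → Top top k → Profile (dihedral k ε) (dihProfile top ε)
  profile-dihedral′ false ε 1≤k k<n  = profile-dihedral ε 1≤k k<n
  profile-dihedral′ true  ε _   refl = profile-top ε

  pairRep-profile : ∀ {j k} top s → j < k → Top top k → Admissible j k s →
    PairProfile (pairRep j k s) (shapeProfile top s)
  pairRep-profile {j} {k} false cyc-cyc j<k k<n _ = profile-cyclic j , profile-cyclic k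
  pairRep-profile true cyc-cyc j<k refl n<n = contradiction n<n (<-irrefl refl)
  pairRep-profile {j} {k} top (cyc-dih ε) j<k k-top _ =
    profile-cyclic j , profile-dihedral′ top ε (≤-trans (s≤s z≤n) j<k) k-top
  pairRep-profile {j} {k} top (dih-dih ε) j<k k-top (1≤j , _) =
    profile-dihedral ε 1≤j (<-≤-trans j<k (Top⇒≤ k-top)) , profile-dihedral′ top ε (≤-trans 1≤j (<⇒≤ j<k)) k-top

  SamePair : Sub n × Sub n → Sub n × Sub n → Set
  SamePair (H , K) (H′ , K′) = SameSub n H H′ × SameSub n K K′

  -- The implicit argument is discharged by evaluation: for concrete shapes it reduces to ⊤ exactly when
  -- their profiles are pairwise distinct.
  classCount : ∀ {j k c} top → j < k → Top top k → (shape : Fin c → Shape) →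
    (∀ i → Admissible j k (shape i)) →
    {_ : True (injective? _≟ˢ_ (shapeProfile top ∘ shape))} →
    (∀ s → Admissible j k s → ∃[ i ] SamePair (pairRep j k (shape i)) (pairRep j k s)) →
    ClassCount n j k c
  classCount {j} {k} top j<k k-top shape admissible {distinct} cover =
    pairRep j k ∘ shape ,
    (λ i → pairRep-isPair (shape i) j<k (Top⇒≤ k-top) (admissible i)) ,
    (λ i i′ conj → toWitness distinct i i′ (sym (pairProfile-conj conj (profile i) (profile i′)))) ,
    covered
    where
    profile : ∀ i → PairProfile (pairRep j k (shape i)) (shapeProfile top (shape i))
    profile i = pairRep-profile top (shape i) j<k k-top (admissible i)
    covered : ∀ P → IsPair n j k P → ∃[ i ] ConjPair n P (pairRep j k (shape i))
    covered P P-pair with classifyPair P-pair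
    ... | s , s-adm , g , H′≅ , K′≅ with cover s s-adm
    ...   | i , H″≅H′ , K″≅K′ = i , g , (λ x → trans (H″≅H′ x) (H′≅ x)) , (λ x → trans (K″≅K′ x) (K′≅ x))

  SamePair-refl : ∀ {P} → SamePair P P
  SamePair-refl = (λ _ → refl) , (λ _ → refl)

  top-cyc-dih : ∀ j ε → SamePair (pairRep j n (cyc-dih false)) (pairRep j n (cyc-dih ε))
  top-cyc-dih j ε = (λ _ → refl) , λ x → trans (dihedral-top≅Dih1 false x) (sym (dihedral-top≅Dih1 ε x))

  1<n : 1 < n
  1<n = s≤s (s≤s z≤n)

  α[0,n]≡1 : ClassCount n 0 n 1
  α[0,n]≡1 = classCount true z<s refl (λ _ → cyc-dih false) (λ _ ()) cover
    where
    cover : ∀ s → Admissible 0 n s → ∃[ i ] SamePair (pairRep 0 n (cyc-dih false)) (pairRep 0 n s)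
    cover cyc-cyc     n<n     = contradiction n<n (<-irrefl refl)
    cover (cyc-dih ε) _       = fzero , top-cyc-dih 0 ε
    cover (dih-dih ε) (() , _)

  α[0,1]≡2 : ClassCount n 0 1 2
  α[0,1]≡2 = classCount false z<s 1<n shape admissible cover
    where
    shape : Fin 2 → Shape
    shape fzero        = cyc-cyc
    shape (fsuc fzero) = cyc-dih false
    admissible : ∀ i → Admissible 0 1 (shape i)
    admissible fzero        = 1<n
    admissible (fsuc fzero) = λ ()
    cover : ∀ s → Admissible 0 1 s → ∃[ i ] SamePair (pairRep 0 1 (shape i)) (pairRep 0 1 s)
    cover cyc-cyc         _        = # 0 , SamePair-refl
    cover (cyc-dih false) _        = # 1 , SamePair-refl
    cover (cyc-dih true)  2≤1      = contradiction (2≤1 _) λ { (s≤s ()) }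
    cover (dih-dih ε)     (() , _)

  α[0,k]≡3 : ∀ k → 2 ≤ k → k < n → ClassCount n 0 k 3
  α[0,k]≡3 k 2≤k k<n = classCount false (<-trans z<s 2≤k) k<n shape admissible cover
    where
    shape : Fin 3 → Shape
    shape fzero               = cyc-cyc
    shape (fsuc fzero)        = cyc-dih false
    shape (fsuc (fsuc fzero)) = cyc-dih true
    admissible : ∀ i → Admissible 0 k (shape i)
    admissible fzero               = k<n
    admissible (fsuc fzero)        = λ ()
    admissible (fsuc (fsuc fzero)) = λ _ → 2≤k
    cover : ∀ s → Admissible 0 k s → ∃[ i ] SamePair (pairRep 0 k (shape i)) (pairRep 0 k s)
    cover cyc-cyc         _        = # 0 , SamePair-refl
    cover (cyc-dih false) _        = # 1 , SamePair-refl
    cover (cyc-dih true)  _        = # 2 , SamePair-refl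
    cover (dih-dih ε)     (() , _)

  α[1,n]≡2 : ClassCount n 1 n 2
  α[1,n]≡2 = classCount true 1<n refl shape admissible cover
    where
    shape : Fin 2 → Shape
    shape fzero        = cyc-dih false
    shape (fsuc fzero) = dih-dih false
    admissible : ∀ i → Admissible 1 n (shape i)
    admissible fzero        = λ ()
    admissible (fsuc fzero) = ≤-refl , λ ()
    cover : ∀ s → Admissible 1 n s → ∃[ i ] SamePair (pairRep 1 n (shape i)) (pairRep 1 n s)
    cover cyc-cyc         n<n       = contradiction n<n (<-irrefl refl)
    cover (cyc-dih ε)     _         = # 0 , top-cyc-dih 1 ε
    cover (dih-dih false) _         = # 1 , SamePair-refl
    cover (dih-dih true)  (_ , 2≤1) = contradiction (2≤1 _) λ { (s≤s ()) }

  α[j,n]≡3 : ∀ j → 2 ≤ j → j < n → ClassCount n j n 3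
  α[j,n]≡3 j 2≤j j<n = classCount true j<n refl shape admissible cover
    where
    shape : Fin 3 → Shape
    shape fzero               = cyc-dih false
    shape (fsuc fzero)        = dih-dih false
    shape (fsuc (fsuc fzero)) = dih-dih true
    admissible : ∀ i → Admissible j n (shape i)
    admissible fzero               = λ ()
    admissible (fsuc fzero)        = <⇒≤ 2≤j , λ ()
    admissible (fsuc (fsuc fzero)) = <⇒≤ 2≤j , λ _ → 2≤j
    cover : ∀ s → Admissible j n s → ∃[ i ] SamePair (pairRep j n (shape i)) (pairRep j n s)
    cover cyc-cyc         n<n = contradiction n<n (<-irrefl refl)
    cover (cyc-dih ε)     _   = # 0 , top-cyc-dih j ε
    cover (dih-dih false) _   = # 1 , SamePair-refl
    cover (dih-dih true)  _   = # 2 , SamePair-refl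

  α[1,k]≡4 : ∀ k → 2 ≤ k → k < n → ClassCount n 1 k 4
  α[1,k]≡4 k 2≤k k<n = classCount false 2≤k k<n shape admissible cover
    where
    shape : Fin 4 → Shape
    shape fzero                      = cyc-cyc
    shape (fsuc fzero)               = cyc-dih false
    shape (fsuc (fsuc fzero))        = cyc-dih true
    shape (fsuc (fsuc (fsuc fzero))) = dih-dih false
    admissible : ∀ i → Admissible 1 k (shape i)
    admissible fzero                      = k<n
    admissible (fsuc fzero)               = λ ()
    admissible (fsuc (fsuc fzero))        = λ _ → 2≤k
    admissible (fsuc (fsuc (fsuc fzero))) = ≤-refl , λ ()
    cover : ∀ s → Admissible 1 k s → ∃[ i ] SamePair (pairRep 1 k (shape i)) (pairRep 1 k s)
    cover cyc-cyc         _         = # 0 , SamePair-refl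
    cover (cyc-dih false) _         = # 1 , SamePair-refl
    cover (cyc-dih true)  _         = # 2 , SamePair-refl
    cover (dih-dih false) _         = # 3 , SamePair-refl
    cover (dih-dih true)  (_ , 2≤1) = contradiction (2≤1 _) λ { (s≤s ()) }

  α[j,k]≡5 : ∀ j k → 2 ≤ j → j < k → k < n → ClassCount n j k 5
  α[j,k]≡5 j k 2≤j j<k k<n = classCount false j<k k<n shape admissible cover
    where
    shape : Fin 5 → Shape
    shape fzero                             = cyc-cyc
    shape (fsuc fzero)                      = cyc-dih false
    shape (fsuc (fsuc fzero))               = cyc-dih true
    shape (fsuc (fsuc (fsuc fzero)))        = dih-dih false
    shape (fsuc (fsuc (fsuc (fsuc fzero)))) = dih-dih true
    admissible : ∀ i → Admissible j k (shape i)
    admissible fzero                             = k<n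
    admissible (fsuc fzero)                      = λ ()
    admissible (fsuc (fsuc fzero))               = λ _ → ≤-trans 2≤j (<⇒≤ j<k)
    admissible (fsuc (fsuc (fsuc fzero)))        = <⇒≤ 2≤j , λ ()
    admissible (fsuc (fsuc (fsuc (fsuc fzero)))) = <⇒≤ 2≤j , λ _ → 2≤j
    cover : ∀ s → Admissible j k s → ∃[ i ] SamePair (pairRep j k (shape i)) (pairRep j k s)
    cover cyc-cyc         _ = # 0 , SamePair-refl
    cover (cyc-dih false) _ = # 1 , SamePair-refl
    cover (cyc-dih true)  _ = # 2 , SamePair-refl
    cover (dih-dih false) _ = # 3 , SamePair-refl
    cover (dih-dih true)  _ = # 4 , SamePair-refl

lemma5p3 : (n : ℕ) → 4 ≤ n →
    ClassCount n 0 n 1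
    × ClassCount n 0 1 2
    × (∀ k → 2 ≤ k → k < n → ClassCount n 0 k 3)
    × ClassCount n 1 n 2
    × (∀ j → 2 ≤ j → j < n → ClassCount n j n 3)
    × (∀ k → 2 ≤ k → k < n → ClassCount n 1 k 4)
    × (∀ j k → 2 ≤ j → j < k → k < n → ClassCount n j k 5)
lemma5p3 _ (s≤s (s≤s (s≤s (s≤s {n = p} _)))) =
  α[0,n]≡1 , α[0,1]≡2 , α[0,k]≡3 , α[1,n]≡2 , α[j,n]≡3 , α[1,k]≡4 , α[j,k]≡5
  where open Semidihedral p
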